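{- Let $G$ be an undirected graph with edge set $E$, fix a reference total orientation $O$ of $G$, and let $\mathcal{D}$ be the vertex set of a single connected component of the cycle-reversal graph $\mathcal{G}_\mu(G)$. For a total orientation $O'$ let $x_{O'}\in\mathbb{R}^E$ be given by $x_{O'}(e)=+1$ if $O$ and $O'$ agree on $e$ and $x_{O'}(e)=-1$ otherwise, and let $P(\mathcal{D})$ be the convex hull of $\{x_{O'}:O'\in\mathcal{D}\}$. Then two orientations $O_1,O_2\in\mathcal{D}$ are related by a cycle reversal if and only if $x_{O_1}$ and $x_{O_2}$ are the endpoints of an edge of the polytope $P(\mathcal{D})$. Thus the restriction of $\mathcal{G}_\mu(G)$ to $\mathcal{D}$ is the $1$-skeleton of $P(\mathcal{D})$.
   Context: A cycle of $G$ means a non-self-intersecting undirected cycle, viewed as a set of edges. Two total orientations $O_1,O_2$ of $G$ are related by a cycle reversal if there is a cycle $C$ of $G$ that both orient as a directed cycle but in opposite directions, while $O_1,O_2$ agree on all edges outside $C$. $\mathcal{G}_\mu(G)$ is the simple graph whose vertices are the total orientations of $G$, two being adjacent iff they are related by a cycle reversal.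
   Formalization: The polytope P(D) lies in ℚ^E instead of ℝ^E: its convex combinations, segment parameters and exposing linear functionals have rational coefficients. -}

module Defs where

open import Data.Nat using (ℕ; zero; suc; _%_)
open import Data.Nat.DivMod using (m%n<n)
open import Data.Fin using (Fin; toℕ; fromℕ<)
open import Data.Bool using (Bool; true; false; not; if_then_else_)
open import Data.Bool.Properties using () renaming (_≟_ to _≟B_)
open import Data.Vec using (Vec; lookup)
open import Data.List using (List; []; _∷_; foldr; map)
open import Data.List.Base using (allFin)
open import Data.List.Relation.Unary.All using (All)
open import Data.Product using (Σ; ∃; ∃-syntax; _×_; _,_; proj₁; proj₂)
open import Data.Rational using (ℚ; 0ℚ; 1ℚ; _+_; _*_; _-_; -_; _≤_)
open import Relation.Binary.PropositionalEquality using (_≡_; _≢_)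
open import Relation.Binary.Construct.Closure.ReflexiveTransitive using (Star)
open import Relation.Nullary using (¬_; does)
open import Function.Bundles using (_⇔_)

Graph : ℕ → ℕ → Set
Graph n m = Fin m → Fin n × Fin n

-- A total orientation: for each edge a Bool.  true means e is directed
-- from  proj₁ (ends e)  to  proj₂ (ends e);  false means the reverse.
Orientation : ℕ → Set
Orientation m = Vec Bool m

Traverses : ∀ {n m} → Graph n m → Fin m → Bool → Fin n → Fin n → Set
Traverses G e true  u v = (proj₁ (G e) ≡ u) × (proj₂ (G e) ≡ v)
Traverses G e false u v = (proj₂ (G e) ≡ u) × (proj₁ (G e) ≡ v)

next : ∀ {k} → Fin (suc k) → Fin (suc k)
next {k} i = fromℕ< (m%n<n (suc (toℕ i)) (suc k))

record Cycle {n m} (G : Graph n m) : Set where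
  field
    len   : ℕ
    vtx   : Fin (suc len) → Fin n
    edg   : Fin (suc len) → Fin m
    dir   : Fin (suc len) → Bool
    vtx-inj : ∀ i j → vtx i ≡ vtx j → i ≡ j
    edg-inj : ∀ i j → edg i ≡ edg j → i ≡ j
    trav  : ∀ i → Traverses G (edg i) (dir i) (vtx i) (vtx (next i))

InCycle : ∀ {n m} {G : Graph n m} → Cycle G → Fin m → Set
InCycle C f = ∃[ i ] (Cycle.edg C i ≡ f)

CycleReversal : ∀ {n m} → Graph n m → Orientation m → Orientation m → Set
CycleReversal G O₁ O₂ = Σ (Cycle G) λ C →
    (∀ i → lookup O₁ (Cycle.edg C i) ≡ Cycle.dir C i)
  × (∀ i → lookup O₂ (Cycle.edg C i) ≡ not (Cycle.dir C i))
  × (∀ f → ¬ InCycle C f → lookup O₁ f ≡ lookup O₂ f)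

IsComponent : ∀ {n m} → Graph n m → (Orientation m → Set) → Set
IsComponent G D =
    (∃[ O ] D O)
  × (∀ O₁ O₂ → D O₁ → CycleReversal G O₁ O₂ → D O₂)
  × (∀ O₁ O₂ → D O₁ → D O₂ → Star (CycleReversal G) O₁ O₂)

Vecℚ : ℕ → Set
Vecℚ m = Fin m → ℚ

signVec : ∀ {m} → Orientation m → Orientation m → Vecℚ m
signVec O O' e = if does (lookup O e ≟B lookup O' e) then 1ℚ else - 1ℚ

sumℚ : List ℚ → ℚ
sumℚ = foldr _+_ 0ℚ

dot : ∀ {m} → Vecℚ m → Vecℚ m → ℚ
dot {m} c y = sumℚ (map (λ e → c e * y e) (allFin m))

InHull : ∀ {m} → Orientation m → (Orientation m → Set) → Vecℚ m → Set
InHull {m} O D y = Σ (List (ℚ × Orientation m)) λ ws →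
    All (λ w → (0ℚ ≤ proj₁ w) × D (proj₂ w)) ws
  × (sumℚ (map proj₁ ws) ≡ 1ℚ)
  × (∀ e → y e ≡ sumℚ (map (λ w → proj₁ w * signVec O (proj₂ w) e) ws))

InSegment : ∀ {m} → Vecℚ m → Vecℚ m → Vecℚ m → Set
InSegment a b y = ∃[ t ] (0ℚ ≤ t) × (t ≤ 1ℚ) × (∀ e → y e ≡ t * a e + (1ℚ - t) * b e)

IsEdgeOf : ∀ {m} → (Vecℚ m → Set) → Vecℚ m → Vecℚ m → Set
IsEdgeOf {m} P a b =
    (∃[ e ] a e ≢ b e)
  × Σ (Vecℚ m) λ c → Σ ℚ λ β →
      (∀ y → P y → dot c y ≤ β)
    × (∀ y → ((P y × dot c y ≡ β) ⇔ InSegment a b y))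

{-# OPTIONS --safe #-}
module Submission where

-- Cycle reversals preserve indegrees, so all orientations in D have the
-- indegrees of any one of them, and the edges on which two of them differ
-- form a balanced digraph (oriented as in the first): every such edge
-- entering a vertex is followed by one leaving it, so these edges contain a
-- directed cycle.
--
-- If O₂ is O₁ with a directed cycle C reversed, the functional
-- c = x_{O₁} + x_{O₂} attains its maximum over P(D) exactly at those
-- x_{O′} with O′ equal to O₁ off C.  Such an O′ in D has the indegrees of
-- O₁, so by balance it differs from O₁ on all of C or on none of it: it is
-- O₁ or O₂, and the face cut out by c is the segment [x_{O₁}, x_{O₂}].
--
-- Conversely, let [x_{O₁}, x_{O₂}] be the face of P(D) cut out by c and pick
-- a directed cycle C of O₁ on which O₁ and O₂ differ.  Reversing C in O₁ and
-- in O₂ gives O₃, O₄ ∈ D with x_{O₃} + x_{O₄} = x_{O₁} + x_{O₂}; as neither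
-- exceeds the maximum of c, x_{O₃} lies on the face, i.e. on the segment.
-- It equals x_{O₂} on C, hence everywhere, so O₁ = O₃ = O₂ off C.

open import Defs
open import Level using (Level; 0ℓ)
open import Data.Nat using (ℕ; zero; suc)
open import Data.Fin using (Fin; zero; suc; toℕ; _≟_)
import Data.Fin.Properties as Fin
open import Data.Bool using (Bool; true; false; not; if_then_else_)
import Data.Bool.Properties as Bool
open import Data.Vec using (lookup; tabulate)
open import Data.Vec.Properties using (lookup∘tabulate)
open import Data.List using (List; []; _∷_; map; allFin)
open import Data.List.Relation.Unary.All as All using (All; []; _∷_)
open import Data.List.Membership.Propositional.Properties using (∈-allFin)
open import Data.Product using (Σ; ∃; ∃₂; ∃-syntax; _×_; _,_; proj₁; proj₂; uncurry)
open import Data.Sum as Sum using (_⊎_; inj₁; inj₂)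
open import Function using (_∘_; _⇔_; mk⇔; Equivalence)
open import Relation.Binary.PropositionalEquality
open import Relation.Binary.Definitions using (tri<; tri≈; tri>)
open import Relation.Binary.Construct.Closure.ReflexiveTransitive using (Star; ε; _◅_)
open import Relation.Nullary using (¬_; Dec; yes; no; does; contradiction; ¬?; _×-dec_)
open import Relation.Nullary.Decidable using (dec-true; dec-false; decidable-stable; True; toWitness)
open import Relation.Unary using (Pred; Decidable)

module Orientations where

  open import Data.Nat using (_+_; _∸_; _<_; _%_; s≤s)
  import Data.Nat.Properties as ℕ
  open import Data.Nat.DivMod using (m<n⇒m%n≡m; n%n≡0)
  open import Algebra.Properties.CommutativeMonoid.Sum ℕ.+-0-commutativeMonoid
    using (sum; ∑-distrib-+; sum-cong-≗; sum-remove; sum-replicate-zero)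
  open import Data.Fin using (fromℕ; fromℕ<; inject; inject₁; opposite; punchIn)
  open import Data.Fin.Induction using (<-weakInduction; <-weakInduction-startingFrom)
  open import Data.Fin.Relation.Unary.Top using (view; ‵fromℕ; ‵inject₁)

  private variable
    ℓ : Level
    k m : ℕ

  next-fromℕ : ∀ k → next (fromℕ k) ≡ zero
  next-fromℕ k = Fin.toℕ-injective (begin
    toℕ (next (fromℕ k))        ≡⟨ Fin.toℕ-fromℕ< _ ⟩
    suc (toℕ (fromℕ k)) % suc k ≡⟨ cong (λ t → suc t % suc k) (Fin.toℕ-fromℕ k) ⟩
    suc k % suc k               ≡⟨ n%n≡0 (suc k) ⟩
    0                           ∎)
    where open ≡-Reasoning

  next-inject₁ : (i : Fin k) → next (inject₁ i) ≡ suc i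
  next-inject₁ {k} i = Fin.toℕ-injective (begin
    toℕ (next (inject₁ i))        ≡⟨ Fin.toℕ-fromℕ< _ ⟩
    suc (toℕ (inject₁ i)) % suc k ≡⟨ cong (λ t → suc t % suc k) (Fin.toℕ-inject₁ i) ⟩
    suc (toℕ i) % suc k           ≡⟨ m<n⇒m%n≡m (s≤s (Fin.toℕ<n i)) ⟩
    suc (toℕ i)                   ∎)
    where open ≡-Reasoning

  next-injective : {i j : Fin (suc k)} → next i ≡ next j → i ≡ j
  next-injective {k} {i} {j} eq with view i | view j
  ... | ‵fromℕ     | ‵fromℕ     = refl
  ... | ‵fromℕ     | ‵inject₁ b with () ← trans (sym (next-fromℕ k)) (trans eq (next-inject₁ b))
  ... | ‵inject₁ a | ‵fromℕ     with () ← trans (sym (next-inject₁ a)) (trans eq (next-fromℕ k))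
  ... | ‵inject₁ a | ‵inject₁ b =
    cong inject₁ (Fin.suc-injective (trans (sym (next-inject₁ a)) (trans eq (next-inject₁ b))))

  next-surjective : (j : Fin (suc k)) → ∃[ i ] next i ≡ j
  next-surjective {k} zero    = fromℕ k , next-fromℕ k
  next-surjective     (suc j) = inject₁ j , next-inject₁ j

  opposite-fromℕ : ∀ k → opposite (fromℕ k) ≡ zero
  opposite-fromℕ zero    = refl
  opposite-fromℕ (suc k) = cong inject₁ (opposite-fromℕ k)

  opposite-inject₁ : (i : Fin k) → opposite (inject₁ i) ≡ suc (opposite i)
  opposite-inject₁ zero    = refl
  opposite-inject₁ (suc i) = cong inject₁ (opposite-inject₁ i)

  opposite-injective : {i j : Fin k} → opposite i ≡ opposite j → i ≡ j
  opposite-injective {i = i} {j} eq =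
    trans (sym (Fin.opposite-involutive i)) (trans (cong opposite eq) (Fin.opposite-involutive j))

  next-opposite-next : (i : Fin (suc k)) → next (opposite (next i)) ≡ opposite i
  next-opposite-next {k} i with view i
  ... | ‵fromℕ = begin
    next (opposite (next (fromℕ k))) ≡⟨ cong (next ∘ opposite) (next-fromℕ k) ⟩
    next (fromℕ k)                   ≡⟨ next-fromℕ k ⟩
    zero                             ≡⟨ opposite-fromℕ k ⟨
    opposite (fromℕ k)               ∎
    where open ≡-Reasoning
  ... | ‵inject₁ j = begin
    next (opposite (next (inject₁ j))) ≡⟨ cong (next ∘ opposite) (next-inject₁ j) ⟩
    next (inject₁ (opposite j))        ≡⟨ next-inject₁ (opposite j) ⟩
    suc (opposite j)                   ≡⟨ opposite-inject₁ j ⟨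
    opposite (inject₁ j)               ∎
    where open ≡-Reasoning

  next-closed⇒universal : (P : Pred (Fin (suc k)) ℓ) → (∀ i → P i → P (next i)) →
                          ∀ {i} → P i → ∀ j → P j
  next-closed⇒universal {k} P step {i} Pi = <-weakInduction P P-zero step-suc
    where
    step-suc : ∀ j → P (inject₁ j) → P (suc j)
    step-suc j = subst P (next-inject₁ j) ∘ step (inject₁ j)
    P-zero : P zero
    P-zero = subst P (next-fromℕ k)
      (step _ (<-weakInduction-startingFrom P Pi step-suc (Fin.≤fromℕ i)))

  𝟙 : {A : Set ℓ} → Dec A → ℕ
  𝟙 a? = if does a? then 1 else 0

  𝟙-cong : {A B : Set ℓ} → A ⇔ B → (a? : Dec A) (b? : Dec B) → 𝟙 a? ≡ 𝟙 b?
  𝟙-cong A⇔B (yes _) (yes _) = refl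
  𝟙-cong A⇔B (no ¬a) (yes b) = contradiction (Equivalence.from A⇔B b) ¬a
  𝟙-cong A⇔B (yes a) (no ¬b) = contradiction (Equivalence.to A⇔B a) ¬b
  𝟙-cong A⇔B (no _)  (no _)  = refl

  count : {P : Pred (Fin m) ℓ} → Decidable P → ℕ
  count P? = sum (𝟙 ∘ P?)

  count-none : {P : Pred (Fin m) ℓ} (P? : Decidable P) → (∀ e → ¬ P e) → count P? ≡ 0
  count-none {m = m} P? ¬P =
    trans (sum-cong-≗ (λ e → cong (λ b → if b then 1 else 0) (dec-false (P? e) (¬P e))))
          (sum-replicate-zero m)

  count-unique : {P : Pred (Fin m) ℓ} (P? : Decidable P) {e₀ : Fin m} →
                 P e₀ → (∀ e → P e → e ≡ e₀) → count P? ≡ 1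
  count-unique {m = suc _} {P = P} P? {e₀} Pe₀ unique = begin
    count P?                             ≡⟨ sum-remove (𝟙 ∘ P?) ⟩
    𝟙 (P? e₀) + count (P? ∘ punchIn e₀)  ≡⟨ cong₂ _+_ 𝟙-P-e₀ (count-none (P? ∘ punchIn e₀) others) ⟩
    1                                    ∎
    where
    open ≡-Reasoning
    𝟙-P-e₀ : 𝟙 (P? e₀) ≡ 1
    𝟙-P-e₀ = cong (λ b → if b then 1 else 0) (dec-true (P? e₀) Pe₀)
    others : ∀ j → ¬ P (punchIn e₀ j)
    others j = Fin.punchInᵢ≢i e₀ j ∘ unique _

  count-witness : {P : Pred (Fin m) ℓ} (P? : Decidable P) {e : Fin m} → P e → count P? ≢ 0
  count-witness {m = suc _} P? {e} Pe count≡0 =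
    ℕ.1+n≢0 (trans (sym 𝟙-P-e) (ℕ.m+n≡0⇒m≡0 (𝟙 (P? e)) (trans (sym (sum-remove (𝟙 ∘ P?))) count≡0)))
    where
    𝟙-P-e : 𝟙 (P? e) ≡ 1
    𝟙-P-e = cong (λ b → if b then 1 else 0) (dec-true (P? e) Pe)

  count-nonzero : {P : Pred (Fin m) ℓ} (P? : Decidable P) → count P? ≢ 0 → ∃ P
  count-nonzero P? count≢0 with Fin.any? P?
  ... | yes ∃P = ∃P
  ... | no  ∄P = contradiction (count-none P? (λ e Pe → ∄P (e , Pe))) count≢0

  -- Orientations and cycle reversals

  module _ {n m : ℕ} (G : Graph n m) where
    open Cycle

    tail head : Orientation m → Fin m → Fin n
    tail O e = if lookup O e then proj₁ (G e) else proj₂ (G e)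
    head O e = if lookup O e then proj₂ (G e) else proj₁ (G e)

    traverses-tail-head : ∀ O e → Traverses G e (lookup O e) (tail O e) (head O e)
    traverses-tail-head O e with lookup O e
    ... | true  = refl , refl
    ... | false = refl , refl

    traverses⇒tail-head : ∀ {O e d u v} → lookup O e ≡ d → Traverses G e d u v →
                          tail O e ≡ u × head O e ≡ v
    traverses⇒tail-head {d = true}  eq uv rewrite eq = uv
    traverses⇒tail-head {d = false} eq uv rewrite eq = uv

    traverses-reverse : ∀ {e d u v} → Traverses G e d u v → Traverses G e (not d) v u
    traverses-reverse {d = true}  (p , q) = q , p
    traverses-reverse {d = false} (p , q) = q , p

    Along Against : Orientation m → Cycle G → Set
    Along   O C = ∀ i → lookup O (edg C i) ≡ dir C i
    Against O C = ∀ i → lookup O (edg C i) ≡ not (dir C i)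

    module _ {O : Orientation m} {C : Cycle G} (along : Along O C) where
      along-tail : ∀ i → tail O (edg C i) ≡ vtx C i
      along-tail i = proj₁ (traverses⇒tail-head {O = O} (along i) (trav C i))

      along-head : ∀ i → head O (edg C i) ≡ vtx C (next i)
      along-head i = proj₂ (traverses⇒tail-head {O = O} (along i) (trav C i))

    InCycle? : (C : Cycle G) → Decidable (InCycle C)
    InCycle? C f = Fin.any? (λ i → edg C i ≟ f)

    InCycle-elim : (C : Cycle G) {P : Fin m → Set ℓ} →
                   (∀ i → P (edg C i)) → (∀ f → ¬ InCycle C f → P f) → ∀ f → P f
    InCycle-elim C on off f with InCycle? C f
    ... | yes (i , refl) = on i
    ... | no  f∉         = off f f∉

    reverse : Cycle G → Cycle G
    reverse C = record
      { len     = len C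
      ; vtx     = vtx C ∘ next ∘ opposite
      ; edg     = edg C ∘ opposite
      ; dir     = not ∘ dir C ∘ opposite
      ; vtx-inj = λ i j → opposite-injective ∘ next-injective ∘ vtx-inj C _ _
      ; edg-inj = λ i j → opposite-injective ∘ edg-inj C _ _
      ; trav    = λ i → subst (Traverses G _ _ _) (cong (vtx C) (sym (next-opposite-next i)))
                              (traverses-reverse (trav C (opposite i)))
      }

    InCycle-reverse : ∀ {C f} → InCycle C f → InCycle (reverse C) f
    InCycle-reverse {C} (i , refl) = opposite i , cong (edg C) (Fin.opposite-involutive i)

    CycleReversal-sym : ∀ {O₁ O₂} → CycleReversal G O₁ O₂ → CycleReversal G O₂ O₁
    CycleReversal-sym (C , along , against , outside) =
      reverse C , against ∘ opposite ,
      (λ i → trans (along (opposite i)) (sym (Bool.not-involutive _))) ,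
      (λ f f∉ → sym (outside f (f∉ ∘ InCycle-reverse {C})))

    reverseOn : Cycle G → Orientation m → Orientation m
    reverseOn C O = tabulate λ f → if does (InCycle? C f) then not (lookup O f) else lookup O f

    module _ (C : Cycle G) (O : Orientation m) where
      private
        lookup-reverseOn : ∀ f → lookup (reverseOn C O) f ≡
                                 (if does (InCycle? C f) then not (lookup O f) else lookup O f)
        lookup-reverseOn = lookup∘tabulate _

      reverseOn-inside : ∀ {f} → InCycle C f → lookup (reverseOn C O) f ≡ not (lookup O f)
      reverseOn-inside {f} f∈ = trans (lookup-reverseOn f)
        (cong (λ b → if b then not (lookup O f) else lookup O f) (dec-true (InCycle? C f) f∈))

      reverseOn-outside : ∀ f → ¬ InCycle C f → lookup (reverseOn C O) f ≡ lookup O f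
      reverseOn-outside f f∉ = trans (lookup-reverseOn f)
        (cong (λ b → if b then not (lookup O f) else lookup O f) (dec-false (InCycle? C f) f∉))

      reverseOn-against : Along O C → Against (reverseOn C O) C
      reverseOn-against along i = trans (reverseOn-inside (i , refl)) (cong not (along i))

      reverseOn-along : Against O C → Along (reverseOn C O) C
      reverseOn-along against i =
        trans (reverseOn-inside (i , refl)) (trans (cong not (against i)) (Bool.not-involutive _))

      reversal-reverseOn : Along O C → CycleReversal G O (reverseOn C O)
      reversal-reverseOn along =
        C , along , reverseOn-against along , λ f f∉ → sym (reverseOn-outside f f∉)

      reverseOn-reversal : Against O C → CycleReversal G (reverseOn C O) O
      reverseOn-reversal against = C , reverseOn-along against , against , reverseOn-outside

    -- Indegrees

    indeg : Orientation m → Fin n → ℕ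
    indeg O v = count (λ e → head O e ≟ v)

    Differ : Orientation m → Orientation m → Pred (Fin m) 0ℓ
    Differ O₁ O₂ e = lookup O₁ e ≢ lookup O₂ e

    differ? : ∀ O₁ O₂ → Decidable (Differ O₁ O₂)
    differ? O₁ O₂ e = ¬? (lookup O₁ e Bool.≟ lookup O₂ e)

    along-against-differ : ∀ {O₁ O₂} (C : Cycle G) → Along O₁ C → Against O₂ C →
                           ∀ i → Differ O₁ O₂ (edg C i)
    along-against-differ C along against i = subst (_ ≢_) (sym (against i)) (Bool.not-¬ (along i))

    inDiffer outDiffer : Orientation m → Orientation m → Fin n → ℕ
    inDiffer  O₁ O₂ v = count (λ e → differ? O₁ O₂ e ×-dec head O₁ e ≟ v)
    outDiffer O₁ O₂ v = count (λ e → differ? O₁ O₂ e ×-dec tail O₁ e ≟ v)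

    -- Turning a differing edge around moves it from the indegree of its O₁-head to that of its O₁-tail.
    indeg-exchange : ∀ O₁ O₂ v → indeg O₁ v + outDiffer O₁ O₂ v ≡ indeg O₂ v + inDiffer O₁ O₂ v
    indeg-exchange O₁ O₂ v = begin
      indeg O₁ v + outDiffer O₁ O₂ v                ≡⟨ ∑-distrib-+ (𝟙 ∘ enters O₁) (𝟙 ∘ out?) ⟨
      sum (λ e → 𝟙 (enters O₁ e) + 𝟙 (out? e))     ≡⟨ sum-cong-≗ exchange ⟩
      sum (λ e → 𝟙 (enters O₂ e) + 𝟙 (in? e))      ≡⟨ ∑-distrib-+ (𝟙 ∘ enters O₂) (𝟙 ∘ in?) ⟩
      indeg O₂ v + inDiffer O₁ O₂ v                 ∎
      where
      open ≡-Reasoning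
      enters : ∀ O e → Dec _
      enters O e = head O e ≟ v
      in? out? : ∀ e → Dec _
      in?  e = differ? O₁ O₂ e ×-dec head O₁ e ≟ v
      out? e = differ? O₁ O₂ e ×-dec tail O₁ e ≟ v
      exchange : ∀ e → 𝟙 (enters O₁ e) + 𝟙 (out? e) ≡ 𝟙 (enters O₂ e) + 𝟙 (in? e)
      exchange e with lookup O₁ e | lookup O₂ e
      ... | true  | true  = refl
      ... | false | false = refl
      ... | true  | false = ℕ.+-comm (𝟙 (proj₂ (G e) ≟ v)) _
      ... | false | true  = ℕ.+-comm (𝟙 (proj₁ (G e) ≟ v)) _

    count-cycle-endpoints : {Q : Pred (Fin m) ℓ} (Q? : Decidable Q) (C : Cycle G) →
      (∀ e → Q e → InCycle C e) → (∀ i → Q (edg C i)) →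
      (f : Fin m → Fin n) (g : Fin (suc (len C)) → Fin n) →
      (∀ i → f (edg C i) ≡ g i) → (∀ i j → g i ≡ g j → i ≡ j) →
      ∀ v (image? : Dec (∃[ i ] g i ≡ v)) → count (λ e → Q? e ×-dec f e ≟ v) ≡ 𝟙 image?
    count-cycle-endpoints {Q = Q} Q? C Q⊆C C⊆Q f g f≡g g-inj v (yes (i , gi≡v)) =
      count-unique (λ e → Q? e ×-dec f e ≟ v) (C⊆Q i , trans (f≡g i) gi≡v) unique
      where
      unique : ∀ e → Q e × f e ≡ v → e ≡ edg C i
      unique e (Qe , fe≡v) with Q⊆C e Qe
      ... | k , refl = cong (edg C) (g-inj k i (trans (sym (f≡g k)) (trans fe≡v (sym gi≡v))))
    count-cycle-endpoints {Q = Q} Q? C Q⊆C C⊆Q f g f≡g g-inj v (no ∄i) =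
      count-none (λ e → Q? e ×-dec f e ≟ v) none
      where
      none : ∀ e → ¬ (Q e × f e ≡ v)
      none e (Qe , fe≡v) with Q⊆C e Qe
      ... | k , refl = ∄i (k , trans (sym (f≡g k)) fe≡v)

    indeg-reversal : ∀ {O₁ O₂} → CycleReversal G O₁ O₂ → ∀ v → indeg O₁ v ≡ indeg O₂ v
    indeg-reversal {O₁} {O₂} (C , along , against , outside) v =
      ℕ.+-cancelʳ-≡ (outDiffer O₁ O₂ v) _ _ (begin
        indeg O₁ v + outDiffer O₁ O₂ v   ≡⟨ indeg-exchange O₁ O₂ v ⟩
        indeg O₂ v + inDiffer O₁ O₂ v    ≡⟨ cong (indeg O₂ v +_) in≡out ⟩
        indeg O₂ v + outDiffer O₁ O₂ v   ∎)
      where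
      open ≡-Reasoning
      Differ⊆C : ∀ e → Differ O₁ O₂ e → InCycle C e
      Differ⊆C e differ = decidable-stable (InCycle? C e) (differ ∘ outside e)
      C⊆Differ : ∀ i → Differ O₁ O₂ (edg C i)
      C⊆Differ = along-against-differ {O₁} {O₂} C along against
      on-cycle? : Dec (∃[ i ] vtx C i ≡ v)
      on-cycle? = Fin.any? (λ i → vtx C i ≟ v)
      on-cycle-next? : Dec (∃[ i ] vtx C (next i) ≡ v)
      on-cycle-next? = Fin.any? (λ i → vtx C (next i) ≟ v)
      same-vertices : (∃[ i ] vtx C (next i) ≡ v) ⇔ (∃[ i ] vtx C i ≡ v)
      same-vertices = mk⇔ (λ (i , eq) → next i , eq)
                          (λ (i , eq) → let j , next-j≡i = next-surjective i
                                        in j , trans (cong (vtx C) next-j≡i) eq)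
      out≡ : outDiffer O₁ O₂ v ≡ 𝟙 on-cycle?
      out≡ = count-cycle-endpoints (differ? O₁ O₂) C Differ⊆C C⊆Differ
               (tail O₁) (vtx C) (along-tail {O₁} {C} along) (vtx-inj C) v on-cycle?
      in≡ : inDiffer O₁ O₂ v ≡ 𝟙 on-cycle-next?
      in≡ = count-cycle-endpoints (differ? O₁ O₂) C Differ⊆C C⊆Differ
              (head O₁) (vtx C ∘ next) (along-head {O₁} {C} along)
              (λ i j → next-injective ∘ vtx-inj C _ _) v on-cycle-next?
      in≡out : inDiffer O₁ O₂ v ≡ outDiffer O₁ O₂ v
      in≡out = trans in≡ (trans (𝟙-cong same-vertices on-cycle-next? on-cycle?) (sym out≡))

    indeg-connected : ∀ {O₁ O₂} → Star (CycleReversal G) O₁ O₂ → ∀ v → indeg O₁ v ≡ indeg O₂ v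
    indeg-connected ε v = refl
    indeg-connected {O₁} (_◅_ {j = O} reversal rest) v =
      trans (indeg-reversal {O₁} {O} reversal v) (indeg-connected rest v)

    differ-continues : ∀ {O₁ O₂} → (∀ v → indeg O₁ v ≡ indeg O₂ v) → ∀ {e} → Differ O₁ O₂ e →
                       ∃[ e′ ] Differ O₁ O₂ e′ × tail O₁ e′ ≡ head O₁ e
    differ-continues {O₁} {O₂} same-indeg {e} differ =
      count-nonzero (λ e′ → differ? O₁ O₂ e′ ×-dec tail O₁ e′ ≟ w)
        (subst (_≢ 0) (sym balanced)
          (count-witness (λ e′ → differ? O₁ O₂ e′ ×-dec head O₁ e′ ≟ w) (differ , refl)))
      where
      w = head O₁ e
      balanced : outDiffer O₁ O₂ w ≡ inDiffer O₁ O₂ w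
      balanced = ℕ.+-cancelˡ-≡ (indeg O₂ w) _ _
        (trans (cong (_+ outDiffer O₁ O₂ w) (sym (same-indeg w))) (indeg-exchange O₁ O₂ w))

  -- Directed cycles inside the difference of two orientations

  least-witness : {R : Pred ℕ ℓ} → Decidable R → ∀ {j} → R j → ∃[ k ] R k × (∀ {i} → i < k → ¬ R i)
  least-witness {R = R} R? {j} Rj
    with k , ¬¬Rk , below ← Fin.¬∀⟶∃¬-smallest (suc j) (¬_ ∘ R ∘ toℕ) (¬? ∘ R? ∘ toℕ)
                              (λ ¬R → ¬R (fromℕ j) (subst R (sym (Fin.toℕ-fromℕ j)) Rj))
    = toℕ k , decidable-stable (R? (toℕ k)) ¬¬Rk ,
      λ i<k → subst (¬_ ∘ R) (toℕ-inject-fromℕ< i<k) (below (fromℕ< i<k))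
    where
    toℕ-inject-fromℕ< : ∀ {i} (i<k : i < toℕ k) → toℕ (inject {i = k} (fromℕ< i<k)) ≡ i
    toℕ-inject-fromℕ< i<k = trans (Fin.toℕ-inject (fromℕ< i<k)) (Fin.toℕ-fromℕ< i<k)

  module _ {n : ℕ} (h : ℕ → Fin n) where
    private
      Repeat : ℕ → Set
      Repeat j = ∃[ i ] h (toℕ {j} i) ≡ h j

      repeat : ∀ {i j} → i < j → h i ≡ h j → Repeat j
      repeat i<j hi≡hj = fromℕ< i<j , trans (cong h (Fin.toℕ-fromℕ< i<j)) hi≡hj

      injective-below : ∀ {j} → (∀ {i} → i < j → ¬ Repeat i) →
                        ∀ {a b} → a < j → b < j → h a ≡ h b → a ≡ b
      injective-below no-repeat {a} {b} a<j b<j ha≡hb with ℕ.<-cmp a b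
      ... | tri≈ _ a≡b _ = a≡b
      ... | tri< a<b _ _ = contradiction (repeat a<b ha≡hb) (no-repeat b<j)
      ... | tri> _ _ b<a = contradiction (repeat b<a (sym ha≡hb)) (no-repeat a<j)

    first-repeat : ∃₂ λ i j → i < j × h i ≡ h j × (∀ {a b} → a < j → b < j → h a ≡ h b → a ≡ b)
    first-repeat
      with i , j , i<j , hi≡hj ← Fin.pigeonhole (ℕ.n<1+n n) (h ∘ toℕ)
      with k , (i′ , hi′≡hk) , earliest ← least-witness (λ j → Fin.any? (λ i → h (toℕ i) ≟ h j))
                                                         (repeat i<j hi≡hj)
      = toℕ i′ , k , Fin.toℕ<n i′ , hi′≡hk , injective-below earliest

  module _ {n m : ℕ} (G : Graph n m) where
    open Cycle

    -- The cycle runs through the walk's heads i, i+1, …, j-1, where j is the first repeated head.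
    walk-cycle : (O : Orientation m) (walk : ℕ → Fin m) →
      (∀ k → tail G O (walk (suc k)) ≡ head G O (walk k)) →
      Σ (Cycle G) λ C → Along G O C × (∀ i → ∃[ k ] edg C i ≡ walk k)
    walk-cycle O walk linked
      with i , j , i<j , hi≡hj , injective ← first-repeat (head G O ∘ walk)
      = C , (λ _ → refl) , (λ a → suc (toℕ a + i) , refl)
      where
      L = j ∸ suc i
      vtx′ : Fin (suc L) → Fin n
      vtx′ a = head G O (walk (toℕ a + i))
      edg′ : Fin (suc L) → Fin m
      edg′ a = walk (suc (toℕ a + i))
      1+L+i≡j : suc (L + i) ≡ j
      1+L+i≡j = trans (sym (ℕ.+-suc L i)) (ℕ.m∸n+n≡m i<j)
      below-j : ∀ (a : Fin (suc L)) → toℕ a + i < j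
      below-j a = subst (toℕ a + i <_) 1+L+i≡j (ℕ.+-monoˡ-< i (s≤s (Fin.toℕ≤pred[n] a)))
      vtx′-injective : ∀ a b → vtx′ a ≡ vtx′ b → a ≡ b
      vtx′-injective a b eq =
        Fin.toℕ-injective (ℕ.+-cancelʳ-≡ i _ _ (injective (below-j a) (below-j b) eq))
      closes : ∀ a → head G O (edg′ a) ≡ vtx′ (next a)
      closes a with view a
      ... | ‵fromℕ = begin
        head G O (walk (suc (toℕ (fromℕ L) + i))) ≡⟨ cong (λ t → head G O (walk (suc (t + i))))
                                                          (Fin.toℕ-fromℕ L) ⟩
        head G O (walk (suc (L + i)))             ≡⟨ cong (head G O ∘ walk) 1+L+i≡j ⟩
        head G O (walk j)                         ≡⟨ hi≡hj ⟨
        vtx′ zero                                 ≡⟨ cong vtx′ (next-fromℕ L) ⟨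
        vtx′ (next (fromℕ L))                     ∎
        where open ≡-Reasoning
      ... | ‵inject₁ b = begin
        head G O (walk (suc (toℕ (inject₁ b) + i))) ≡⟨ cong (λ t → head G O (walk (suc (t + i))))
                                                            (Fin.toℕ-inject₁ b) ⟩
        vtx′ (suc b)                                ≡⟨ cong vtx′ (next-inject₁ b) ⟨
        vtx′ (next (inject₁ b))                     ∎
        where open ≡-Reasoning
      C : Cycle G
      C = record
        { len     = L
        ; vtx     = vtx′
        ; edg     = edg′
        ; dir     = lookup O ∘ edg′
        ; vtx-inj = vtx′-injective
        ; edg-inj = λ a b eq → vtx′-injective a b
            (trans (sym (linked (toℕ a + i))) (trans (cong (tail G O) eq) (linked (toℕ b + i))))
        ; trav    = λ a → subst₂ (Traverses G (edg′ a) (lookup O (edg′ a)))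
                            (linked (toℕ a + i)) (closes a) (traverses-tail-head G O (edg′ a))
        }

    differ-cycle : ∀ {O₁ O₂} → (∀ v → indeg G O₁ v ≡ indeg G O₂ v) → ∀ {e} → Differ G O₁ O₂ e →
                   Σ (Cycle G) λ C → Along G O₁ C × (∀ i → Differ G O₁ O₂ (edg C i))
    differ-cycle {O₁} {O₂} same-indeg {e} differ =
      let C , along , from-walk = walk-cycle O₁ (proj₁ ∘ walk) linked
      in  C , along , λ i → let k , eq = from-walk i in subst (Differ G O₁ O₂) (sym eq) (proj₂ (walk k))
      where
      walk : ℕ → Σ (Fin m) (Differ G O₁ O₂)
      walk zero    = e , differ
      walk (suc k) = let e′ , differ′ , _ = differ-continues G {O₁} {O₂} same-indeg (proj₂ (walk k))
                     in  e′ , differ′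
      linked : ∀ k → tail G O₁ (proj₁ (walk (suc k))) ≡ head G O₁ (proj₁ (walk k))
      linked k = proj₂ (proj₂ (differ-continues G {O₁} {O₂} same-indeg (proj₂ (walk k))))

    agree-or-differ-on-cycle : ∀ {O₁ O′} (C : Cycle G) → Along G O₁ C →
      (∀ f → ¬ InCycle C f → lookup O₁ f ≡ lookup O′ f) → (∀ v → indeg G O₁ v ≡ indeg G O′ v) →
      (∀ i → lookup O′ (edg C i) ≡ lookup O₁ (edg C i)) ⊎ (∀ i → Differ G O₁ O′ (edg C i))
    agree-or-differ-on-cycle {O₁} {O′} C along outside same-indeg
      with Fin.any? (λ i → differ? G O₁ O′ (edg C i))
    ... | yes (i , differ) = inj₂ (next-closed⇒universal (Differ G O₁ O′ ∘ edg C) propagates differ)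
      where
      -- the differing edge leaving vtx (next i), supplied by balance, lies on C and so is edg (next i)
      propagates : ∀ i → Differ G O₁ O′ (edg C i) → Differ G O₁ O′ (edg C (next i))
      propagates i differ
        with e′ , differ′ , tail≡head ← differ-continues G {O₁} {O′} same-indeg differ
        with k , refl ← decidable-stable (InCycle? G C e′) (differ′ ∘ outside e′)
        = subst (Differ G O₁ O′ ∘ edg C)
            (vtx-inj C k (next i)
              (trans (sym (along-tail G {O₁} {C} along k)) (trans tail≡head (along-head G {O₁} {C} along i))))
            differ′
    ... | no ∄i = inj₁ λ i →
      sym (decidable-stable (lookup O₁ (edg C i) Bool.≟ lookup O′ (edg C i)) (∄i ∘ (i ,_)))

    agree-off-reversed-cycle : ∀ {O₁ O₂ O′} → ((C , _) : CycleReversal G O₁ O₂) →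
      (∀ f → ¬ InCycle C f → lookup O₁ f ≡ lookup O′ f) → (∀ v → indeg G O₁ v ≡ indeg G O′ v) →
      (∀ f → lookup O′ f ≡ lookup O₁ f) ⊎ (∀ f → lookup O′ f ≡ lookup O₂ f)
    agree-off-reversed-cycle {O₁} {O₂} {O′} (C , along , against , outside) agree-off same-indeg
      with agree-or-differ-on-cycle {O₁} {O′} C along agree-off same-indeg
    ... | inj₁ agree-on  = inj₁ (InCycle-elim G C agree-on (λ f f∉ → sym (agree-off f f∉)))
    ... | inj₂ differ-on = inj₂ (InCycle-elim G C
            (λ i → trans (Bool.¬-not (differ-on i ∘ sym)) (trans (cong not (along i)) (sym (against i))))
            (λ f f∉ → trans (sym (agree-off f f∉)) (outside f f∉)))

module Polytope where

  open import Data.Rational using (ℚ; 0ℚ; 1ℚ; _+_; _*_; _-_; -_; _≤_; 1/_)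
  import Data.Rational as ℚ
  import Data.Rational.Properties as ℚ
  open import Data.Rational.Solver using (module +-*-Solver)
  open +-*-Solver

  private variable
    a : Level
    A : Set a
    m : ℕ

  ∑ : List A → (A → ℚ) → ℚ
  ∑ xs f = sumℚ (map f xs)

  module _ {f g : A → ℚ} where

    ∑-cong : ∀ {xs} → All (λ x → f x ≡ g x) xs → ∑ xs f ≡ ∑ xs g
    ∑-cong []           = refl
    ∑-cong (fx≡gx ∷ eq) = cong₂ _+_ fx≡gx (∑-cong eq)

    ∑-+ : ∀ xs → ∑ xs (λ x → f x + g x) ≡ ∑ xs f + ∑ xs g
    ∑-+ []       = sym (ℚ.+-identityʳ 0ℚ)
    ∑-+ (x ∷ xs) = trans (cong (f x + g x +_) (∑-+ xs))
      (solve 4 (λ a b c d → (a :+ b) :+ (c :+ d) := (a :+ c) :+ (b :+ d)) refl (f x) (g x) (∑ xs f) (∑ xs g))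

    ∑-mono-≤ : ∀ {xs} → All (λ x → f x ≤ g x) xs → ∑ xs f ≤ ∑ xs g
    ∑-mono-≤ []           = ℚ.≤-refl
    ∑-mono-≤ (fx≤gx ∷ le) = ℚ.+-mono-≤ fx≤gx (∑-mono-≤ le)

  ∑-0 : ∀ (xs : List A) → ∑ xs (λ _ → 0ℚ) ≡ 0ℚ
  ∑-0 []       = refl
  ∑-0 (x ∷ xs) = trans (ℚ.+-identityˡ _) (∑-0 xs)

  ∑-*ˡ : ∀ k (f : A → ℚ) xs → ∑ xs (λ x → k * f x) ≡ k * ∑ xs f
  ∑-*ˡ k f []       = sym (ℚ.*-zeroʳ k)
  ∑-*ˡ k f (x ∷ xs) = trans (cong (k * f x +_) (∑-*ˡ k f xs)) (sym (ℚ.*-distribˡ-+ k (f x) (∑ xs f)))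

  ∑-*ʳ : ∀ k (f : A → ℚ) xs → ∑ xs (λ x → f x * k) ≡ ∑ xs f * k
  ∑-*ʳ k f []       = sym (ℚ.*-zeroˡ k)
  ∑-*ʳ k f (x ∷ xs) = trans (cong (f x * k +_) (∑-*ʳ k f xs)) (sym (ℚ.*-distribʳ-+ k (f x) (∑ xs f)))

  ∑-comm : ∀ {b} {B : Set b} (F : A → B → ℚ) xs ys →
           ∑ xs (λ x → ∑ ys (F x)) ≡ ∑ ys (λ y → ∑ xs (λ x → F x y))
  ∑-comm F xs []       = ∑-0 xs
  ∑-comm F xs (y ∷ ys) = trans (∑-+ {f = λ x → F x y} {g = λ x → ∑ ys (F x)} xs)
                               (cong (∑ xs (λ x → F x y) +_) (∑-comm F xs ys))

  +-mono-≤-≡ˡ : ∀ {p q r s} → p ≤ q → r ≤ s → p + r ≡ q + s → p ≡ q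
  +-mono-≤-≡ˡ {p} {q} p≤q r≤s eq with ℚ.<-cmp p q
  ... | tri≈ _ p≡q _ = p≡q
  ... | tri< p<q _ _ = contradiction eq (ℚ.<⇒≢ (ℚ.+-mono-<-≤ p<q r≤s))
  ... | tri> _ _ q<p = contradiction (ℚ.≤-<-trans p≤q q<p) (ℚ.<-irrefl refl)

  +-mono-≤-≡ʳ : ∀ {p q r s} → p ≤ q → r ≤ s → p + r ≡ q + s → r ≡ s
  +-mono-≤-≡ʳ {p} {q} {r} {s} p≤q r≤s eq =
    +-mono-≤-≡ˡ r≤s p≤q (trans (ℚ.+-comm r p) (trans eq (ℚ.+-comm q s)))

  ∑-mono-≤-≡ : ∀ {f g : A → ℚ} {xs} → All (λ x → f x ≤ g x) xs → ∑ xs f ≡ ∑ xs g →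
               All (λ x → f x ≡ g x) xs
  ∑-mono-≤-≡ []           eq = []
  ∑-mono-≤-≡ (fx≤gx ∷ le) eq =
    +-mono-≤-≡ˡ fx≤gx (∑-mono-≤ le) eq ∷ ∑-mono-≤-≡ le (+-mono-≤-≡ʳ fx≤gx (∑-mono-≤ le) eq)

  *-cancelʳ-≡ : ∀ {p q} r → r ≢ 0ℚ → p * r ≡ q * r → p ≡ q
  *-cancelʳ-≡ {p} {q} r r≢0 eq = begin
    p                ≡⟨ ℚ.*-identityʳ p ⟨
    p * 1ℚ           ≡⟨ cong (p *_) (ℚ.*-inverseʳ r) ⟨
    p * (r * 1/ r)   ≡⟨ ℚ.*-assoc p r (1/ r) ⟨
    (p * r) * 1/ r   ≡⟨ cong (_* 1/ r) eq ⟩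
    (q * r) * 1/ r   ≡⟨ ℚ.*-assoc q r (1/ r) ⟩
    q * (r * 1/ r)   ≡⟨ cong (q *_) (ℚ.*-inverseʳ r) ⟩
    q * 1ℚ           ≡⟨ ℚ.*-identityʳ q ⟩
    q                ∎
    where
    open ≡-Reasoning
    instance _ = ℚ.≢-nonZero r≢0

  +-nonNeg : ∀ {p q} → 0ℚ ≤ p → 0ℚ ≤ q → 0ℚ ≤ p + q
  +-nonNeg {p} {q} 0≤p 0≤q = subst (_≤ p + q) (ℚ.+-identityʳ 0ℚ) (ℚ.+-mono-≤ 0≤p 0≤q)

  -- Segments, convex hulls and faces

  dot-cong : ∀ c {y y′ : Vecℚ m} → (∀ e → y e ≡ y′ e) → dot c y ≡ dot c y′
  dot-cong {m} c y≗y′ = ∑-cong (All.universal (λ e → cong (c e *_) (y≗y′ e)) (allFin m))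

  dot-+ : ∀ c (y y′ : Vecℚ m) → dot c (λ e → y e + y′ e) ≡ dot c y + dot c y′
  dot-+ {m} c y y′ = trans (∑-cong (All.universal (λ e → ℚ.*-distribˡ-+ (c e) (y e) (y′ e)) (allFin m)))
                           (∑-+ (allFin m))

  dot-*ˡ : ∀ c t (y : Vecℚ m) → dot c (λ e → t * y e) ≡ t * dot c y
  dot-*ˡ {m} c t y = trans
    (∑-cong (All.universal (λ e → solve 3 (λ c t y → c :* (t :* y) := t :* (c :* y)) refl (c e) t (y e)) (allFin m)))
    (∑-*ˡ t (λ e → c e * y e) (allFin m))

  dot-segment : ∀ c t (a b : Vecℚ m) →
    dot c (λ e → t * a e + (1ℚ - t) * b e) ≡ t * dot c a + (1ℚ - t) * dot c b
  dot-segment c t a b = begin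
    dot c (λ e → t * a e + (1ℚ - t) * b e)                ≡⟨ dot-+ c _ _ ⟩
    dot c (λ e → t * a e) + dot c (λ e → (1ℚ - t) * b e)  ≡⟨ cong₂ _+_ (dot-*ˡ c t a) (dot-*ˡ c (1ℚ - t) b) ⟩
    t * dot c a + (1ℚ - t) * dot c b                      ∎
    where open ≡-Reasoning

  left∈segment : (a b : Vecℚ m) → InSegment a b a
  left∈segment a b = 1ℚ , ℚ.nonNegative⁻¹ 1ℚ , ℚ.≤-refl ,
    λ e → solve 2 (λ a b → a := con 1ℚ :* a :+ (con 1ℚ :- con 1ℚ) :* b) refl (a e) (b e)

  right∈segment : (a b : Vecℚ m) → InSegment a b b
  right∈segment a b = 0ℚ , ℚ.≤-refl , ℚ.nonNegative⁻¹ 1ℚ ,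
    λ e → solve 2 (λ a b → b := con 0ℚ :* a :+ (con 1ℚ :- con 0ℚ) :* b) refl (a e) (b e)

  segment-meets-right : ∀ {a b y : Vecℚ m} → InSegment a b y → ∀ {e} → a e ≢ b e → y e ≡ b e →
                        ∀ e′ → y e′ ≡ b e′
  segment-meets-right {a = a} {b} {y} (t , _ , _ , y≡) {e} aₑ≢bₑ yₑ≡bₑ e′ = begin
    y e′                          ≡⟨ y≡ e′ ⟩
    t * a e′ + (1ℚ - t) * b e′    ≡⟨ cong (λ s → s * a e′ + (1ℚ - s) * b e′) t≡0 ⟩
    0ℚ * a e′ + (1ℚ - 0ℚ) * b e′  ≡⟨ solve 2 (λ a b → con 0ℚ :* a :+ (con 1ℚ :- con 0ℚ) :* b := b)
                                             refl (a e′) (b e′) ⟩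
    b e′                          ∎
    where
    open ≡-Reasoning
    aₑ-bₑ≢0 : a e - b e ≢ 0ℚ
    aₑ-bₑ≢0 d≡0 = aₑ≢bₑ (begin
      a e                ≡⟨ solve 2 (λ a b → a := (a :- b) :+ b) refl (a e) (b e) ⟩
      (a e - b e) + b e  ≡⟨ cong (_+ b e) d≡0 ⟩
      0ℚ + b e           ≡⟨ ℚ.+-identityˡ (b e) ⟩
      b e                ∎)
    t≡0 : t ≡ 0ℚ
    t≡0 = *-cancelʳ-≡ (a e - b e) aₑ-bₑ≢0 (begin
      t * (a e - b e)                   ≡⟨ solve 3 (λ t a b → t :* (a :- b) := (t :* a :+ (con 1ℚ :- t) :* b) :- b)
                                                   refl t (a e) (b e) ⟩
      (t * a e + (1ℚ - t) * b e) - b e  ≡⟨ cong (_- b e) (trans (sym (y≡ e)) yₑ≡bₑ) ⟩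
      b e - b e                         ≡⟨ ℚ.+-inverseʳ (b e) ⟩
      0ℚ                                ≡⟨ ℚ.*-zeroˡ (a e - b e) ⟨
      0ℚ * (a e - b e)                  ∎)

  module _ {A : Set} (v : A → Vecℚ m) where

    combination : List (ℚ × A) → Vecℚ m
    combination ws e = ∑ ws (λ w → proj₁ w * v (proj₂ w) e)

    module _ {a b : Vecℚ m} where

      OnSegment : ℚ × A → Set
      OnSegment (l , x) = l ≡ 0ℚ ⊎ (∀ e → v x e ≡ a e) ⊎ (∀ e → v x e ≡ b e)

      conic-combination : ∀ ws → All (λ w → 0ℚ ≤ proj₁ w) ws → All OnSegment ws →
        ∃[ t ] ∃[ u ] 0ℚ ≤ t × 0ℚ ≤ u × t + u ≡ ∑ ws proj₁ ×
                      (∀ e → combination ws e ≡ t * a e + u * b e)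
      conic-combination [] [] [] =
        0ℚ , 0ℚ , ℚ.≤-refl , ℚ.≤-refl , refl ,
        λ e → solve 2 (λ a b → con 0ℚ := con 0ℚ :* a :+ con 0ℚ :* b) refl (a e) (b e)
      conic-combination ((l , x) ∷ ws) (0≤l ∷ nonNeg) (onSeg ∷ onSegs)
        with t , u , 0≤t , 0≤u , t+u≡ , comb≡ ← conic-combination ws nonNeg onSegs
        with onSeg
      ... | inj₁ refl = t , u , 0≤t , 0≤u ,
        trans t+u≡ (sym (ℚ.+-identityˡ _)) ,
        λ e → trans (cong₂ _+_ (ℚ.*-zeroˡ (v x e)) (comb≡ e)) (ℚ.+-identityˡ _)
      ... | inj₂ (inj₁ x≗a) = l + t , u , +-nonNeg 0≤l 0≤t , 0≤u ,
        trans (ℚ.+-assoc l t u) (cong (l +_) t+u≡) ,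
        λ e → trans (cong₂ _+_ (cong (l *_) (x≗a e)) (comb≡ e))
          (solve 5 (λ l t u a b → l :* a :+ (t :* a :+ u :* b) := (l :+ t) :* a :+ u :* b) refl l t u (a e) (b e))
      ... | inj₂ (inj₂ x≗b) = t , l + u , 0≤t , +-nonNeg 0≤l 0≤u ,
        trans (solve 3 (λ l t u → t :+ (l :+ u) := l :+ (t :+ u)) refl l t u) (cong (l +_) t+u≡) ,
        λ e → trans (cong₂ _+_ (cong (l *_) (x≗b e)) (comb≡ e))
          (solve 5 (λ l t u a b → l :* b :+ (t :* a :+ u :* b) := t :* a :+ (l :+ u) :* b) refl l t u (a e) (b e))

      combination∈segment : ∀ ws → All (λ w → 0ℚ ≤ proj₁ w) ws → ∑ ws proj₁ ≡ 1ℚ →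
                            All OnSegment ws → InSegment a b (combination ws)
      combination∈segment ws nonNeg ∑≡1 onSegs
        with t , u , 0≤t , 0≤u , t+u≡ , comb≡ ← conic-combination ws nonNeg onSegs
        = t , 0≤t , t≤1 , λ e → trans (comb≡ e) (cong (λ s → t * a e + s * b e) u≡1-t)
        where
        t+u≡1 : t + u ≡ 1ℚ
        t+u≡1 = trans t+u≡ ∑≡1
        t≤1 : t ≤ 1ℚ
        t≤1 = subst₂ _≤_ (ℚ.+-identityʳ t) t+u≡1 (ℚ.+-monoʳ-≤ t 0≤u)
        u≡1-t : u ≡ 1ℚ - t
        u≡1-t = trans (solve 2 (λ t u → u := (t :+ u) :- t) refl t u) (cong (_- t) t+u≡1)

  module _ {m : ℕ} (O : Orientation m) (D : Orientation m → Set) where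

    private
      x : Orientation m → Vecℚ m
      x = signVec O

    dot-combination : ∀ c (ws : List (ℚ × Orientation m)) →
                      dot c (combination x ws) ≡ ∑ ws (λ w → proj₁ w * dot c (x (proj₂ w)))
    dot-combination c ws = begin
      dot c (combination x ws)
        ≡⟨ ∑-cong (All.universal (λ e → sym (∑-*ˡ (c e) (λ w → proj₁ w * x (proj₂ w) e) ws)) (allFin m)) ⟩
      ∑ (allFin m) (λ e → ∑ ws (λ w → c e * (proj₁ w * x (proj₂ w) e)))
        ≡⟨ ∑-comm (λ e w → c e * (proj₁ w * x (proj₂ w) e)) (allFin m) ws ⟩
      ∑ ws (λ w → ∑ (allFin m) (λ e → c e * (proj₁ w * x (proj₂ w) e)))
        ≡⟨ ∑-cong (All.universal (λ w → dot-*ˡ c (proj₁ w) (x (proj₂ w))) ws) ⟩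
      ∑ ws (λ w → proj₁ w * dot c (x (proj₂ w)))
        ∎
      where open ≡-Reasoning

    vertex∈hull : ∀ {O′} → D O′ → InHull O D (x O′)
    vertex∈hull {O′} O′∈D = (1ℚ , O′) ∷ [] , (ℚ.nonNegative⁻¹ 1ℚ , O′∈D) ∷ [] , refl ,
      λ e → sym (trans (ℚ.+-identityʳ _) (ℚ.*-identityˡ _))

    segment⊆hull : ∀ {O₁ O₂ y} → D O₁ → D O₂ → InSegment (x O₁) (x O₂) y → InHull O D y
    segment⊆hull {O₁} {O₂} O₁∈D O₂∈D (t , 0≤t , t≤1 , y≡) =
      (t , O₁) ∷ (1ℚ - t , O₂) ∷ [] ,
      (0≤t , O₁∈D) ∷ (0≤1-t , O₂∈D) ∷ [] ,
      solve 1 (λ t → t :+ ((con 1ℚ :- t) :+ con 0ℚ) := con 1ℚ) refl t ,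
      λ e → trans (y≡ e) (cong (t * x O₁ e +_) (sym (ℚ.+-identityʳ _)))
      where
      0≤1-t : 0ℚ ≤ 1ℚ - t
      0≤1-t = subst (_≤ 1ℚ - t) (ℚ.+-inverseʳ t) (ℚ.+-monoˡ-≤ (- t) t≤1)

    segment⊆face : ∀ {c β O₁ O₂} → D O₁ → D O₂ → dot c (x O₁) ≡ β → dot c (x O₂) ≡ β →
                   ∀ {y} → InSegment (x O₁) (x O₂) y → InHull O D y × dot c y ≡ β
    segment⊆face {c} {β} {O₁} {O₂} O₁∈D O₂∈D dot₁≡β dot₂≡β {y} seg@(t , _ , _ , y≡) =
      segment⊆hull O₁∈D O₂∈D seg , (begin
        dot c y                                       ≡⟨ dot-cong c y≡ ⟩
        dot c (λ e → t * x O₁ e + (1ℚ - t) * x O₂ e)  ≡⟨ dot-segment c t (x O₁) (x O₂) ⟩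
        t * dot c (x O₁) + (1ℚ - t) * dot c (x O₂)    ≡⟨ cong₂ (λ p q → t * p + (1ℚ - t) * q) dot₁≡β dot₂≡β ⟩
        t * β + (1ℚ - t) * β                          ≡⟨ solve 2 (λ t β → t :* β :+ (con 1ℚ :- t) :* β := β) refl t β ⟩
        β                                             ∎)
      where open ≡-Reasoning

    module _ {c : Vecℚ m} {β : ℚ} (bounded : ∀ O′ → D O′ → dot c (x O′) ≤ β) where

      private
        weighted-bound : ∀ (ws : List (ℚ × Orientation m)) → All (λ w → 0ℚ ≤ proj₁ w × D (proj₂ w)) ws →
                         All (λ w → proj₁ w * dot c (x (proj₂ w)) ≤ proj₁ w * β) ws
        weighted-bound ws = All.map λ { {l , O′} (0≤l , O′∈D) →
          ℚ.*-monoˡ-≤-nonNeg l {{ℚ.nonNegative 0≤l}} (bounded O′ O′∈D) }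

        ∑-weights-β : ∀ (ws : List (ℚ × Orientation m)) → ∑ ws proj₁ ≡ 1ℚ → ∑ ws (λ w → proj₁ w * β) ≡ β
        ∑-weights-β ws ∑≡1 = trans (∑-*ʳ β proj₁ ws) (trans (cong (_* β) ∑≡1) (ℚ.*-identityˡ β))

      hull-bounded : ∀ {y} → InHull O D y → dot c y ≤ β
      hull-bounded {y} (ws , valid , ∑≡1 , y≡) =
        subst₂ _≤_ (sym (trans (dot-cong c y≡) (dot-combination c ws))) (∑-weights-β ws ∑≡1)
          (∑-mono-≤ (weighted-bound ws valid))

      face⊆segment : ∀ {a b} →
        (∀ O′ → D O′ → dot c (x O′) ≡ β → (∀ e → x O′ e ≡ a e) ⊎ (∀ e → x O′ e ≡ b e)) →
        ∀ {y} → InHull O D y → dot c y ≡ β → InSegment a b y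
      face⊆segment {a} {b} maximisers {y} (ws , valid , ∑≡1 , y≡) dot≡β =
        let t , 0≤t , t≤1 , comb≡ = combination∈segment x ws (All.map proj₁ valid) ∑≡1
                                      (All.zipWith on-segment (valid , tight))
        in  t , 0≤t , t≤1 , λ e → trans (y≡ e) (comb≡ e)
        where
        tight : All (λ w → proj₁ w * dot c (x (proj₂ w)) ≡ proj₁ w * β) ws
        tight = ∑-mono-≤-≡ (weighted-bound ws valid) (begin
          ∑ ws (λ w → proj₁ w * dot c (x (proj₂ w)))  ≡⟨ dot-combination c ws ⟨
          dot c (combination x ws)                     ≡⟨ dot-cong c y≡ ⟨
          dot c y                                      ≡⟨ dot≡β ⟩
          β                                            ≡⟨ ∑-weights-β ws ∑≡1 ⟨
          ∑ ws (λ w → proj₁ w * β)                     ∎)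
          where open ≡-Reasoning
        on-segment : ∀ {w} → (0ℚ ≤ proj₁ w × D (proj₂ w)) × proj₁ w * dot c (x (proj₂ w)) ≡ proj₁ w * β →
                     OnSegment x {a} {b} w
        on-segment {l , O′} ((_ , O′∈D) , l*dot≡l*β) with l ℚ.≟ 0ℚ
        ... | yes l≡0 = inj₁ l≡0
        ... | no  l≢0 = inj₂ (maximisers O′ O′∈D
                (*-cancelʳ-≡ l l≢0 (trans (ℚ.*-comm _ l) (trans l*dot≡l*β (ℚ.*-comm l β)))))

  -- Sign vectors

  sign : Bool → ℚ
  sign d = if d then 1ℚ else - 1ℚ

  private
    decide-≤ : ∀ {p q} {p≤q : True (p ℚ.≤? q)} → p ≤ q
    decide-≤ {p≤q = p≤q} = toWitness p≤q

  sign-injective : ∀ {d₁ d₂} → sign d₁ ≡ sign d₂ → d₁ ≡ d₂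
  sign-injective {true}  {true}  _  = refl
  sign-injective {false} {false} _  = refl
  sign-injective {true}  {false} ()
  sign-injective {false} {true}  ()

  does-≟-injective : ∀ a {b₁ b₂} → does (a Bool.≟ b₁) ≡ does (a Bool.≟ b₂) → b₁ ≡ b₂
  does-≟-injective true  {true}  {true}  _ = refl
  does-≟-injective true  {false} {false} _ = refl
  does-≟-injective false {true}  {true}  _ = refl
  does-≟-injective false {false} {false} _ = refl
  does-≟-injective true  {true}  {false} ()
  does-≟-injective true  {false} {true}  ()
  does-≟-injective false {true}  {false} ()
  does-≟-injective false {false} {true}  ()

  pair-bound : ∀ d₁ d₂ d → (sign d₁ + sign d₂) * sign d ≤ (sign d₁ + sign d₂) * sign d₁
  pair-bound true  true  true  = ℚ.≤-refl
  pair-bound true  true  false = decide-≤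
  pair-bound false false true  = decide-≤
  pair-bound false false false = ℚ.≤-refl
  pair-bound true  false true  = ℚ.≤-refl
  pair-bound true  false false = ℚ.≤-refl
  pair-bound false true  true  = ℚ.≤-refl
  pair-bound false true  false = ℚ.≤-refl

  pair-symmetric : ∀ d₁ d₂ → (sign d₁ + sign d₂) * sign d₂ ≡ (sign d₁ + sign d₂) * sign d₁
  pair-symmetric true  true  = refl
  pair-symmetric true  false = refl
  pair-symmetric false true  = refl
  pair-symmetric false false = refl

  pair-tight : ∀ d₁ d → (sign d₁ + sign d₁) * sign d ≡ (sign d₁ + sign d₁) * sign d₁ → d ≡ d₁
  pair-tight true  true  _ = refl
  pair-tight false false _ = refl
  pair-tight true  false ()
  pair-tight false true  ()

  module _ {m : ℕ} (O : Orientation m) where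

    signVec-injective : ∀ O₁ O₂ e → signVec O O₁ e ≡ signVec O O₂ e → lookup O₁ e ≡ lookup O₂ e
    signVec-injective _ _ e = does-≟-injective (lookup O e) ∘ sign-injective

    signVec-cong : ∀ O₁ O₂ e → lookup O₁ e ≡ lookup O₂ e → signVec O O₁ e ≡ signVec O O₂ e
    signVec-cong _ _ e = cong (λ b → sign (does (lookup O e Bool.≟ b)))

    -- Its entry at e is ±2 (with the sign of signVec O O₁ e) where O₁ and O₂ agree and 0 where they
    -- differ, so its maximisers are the orientations that agree with O₁ wherever O₁ and O₂ agree.
    pairFunctional : Orientation m → Orientation m → Vecℚ m
    pairFunctional O₁ O₂ e = signVec O O₁ e + signVec O O₂ e

    module _ (O₁ O₂ : Orientation m) where
      private
        c = pairFunctional O₁ O₂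
        agrees : Orientation m → Fin m → Bool
        agrees O′ e = does (lookup O e Bool.≟ lookup O′ e)
        pointwise-bound : ∀ O′ → All (λ e → c e * signVec O O′ e ≤ c e * signVec O O₁ e) (allFin m)
        pointwise-bound O′ =
          All.universal (λ e → pair-bound (agrees O₁ e) (agrees O₂ e) (agrees O′ e)) (allFin m)

      pairFunctional-bound : ∀ O′ → dot c (signVec O O′) ≤ dot c (signVec O O₁)
      pairFunctional-bound O′ = ∑-mono-≤ (pointwise-bound O′)

      pairFunctional-symmetric : dot c (signVec O O₂) ≡ dot c (signVec O O₁)
      pairFunctional-symmetric =
        ∑-cong (All.universal (λ e → pair-symmetric (agrees O₁ e) (agrees O₂ e)) (allFin m))

      pairFunctional-maximiser : ∀ {O′} → dot c (signVec O O′) ≡ dot c (signVec O O₁) →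
                                 ∀ f → lookup O₁ f ≡ lookup O₂ f → lookup O′ f ≡ lookup O₁ f
      pairFunctional-maximiser {O′} max f O₁≡O₂ =
        does-≟-injective (lookup O f) (pair-tight (agrees O₁ f) (agrees O′ f)
          (subst (λ d → (sign (agrees O₁ f) + sign d) * sign (agrees O′ f) ≡
                        (sign (agrees O₁ f) + sign d) * sign (agrees O₁ f))
                 (cong (λ b → does (lookup O f Bool.≟ b)) (sym O₁≡O₂))
                 (All.lookup (∑-mono-≤-≡ (pointwise-bound O′) max) (∈-allFin f))))

open Orientations
open Polytope

signVec-differ-on-cycle : ∀ {n m} (G : Graph n m) (O : Orientation m) {O₁ O₂} (C : Cycle G) →
  Along G O₁ C → Against G O₂ C → ∀ i → signVec O O₁ (Cycle.edg C i) ≢ signVec O O₂ (Cycle.edg C i)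
signVec-differ-on-cycle G O {O₁} {O₂} C along against i =
  along-against-differ G {O₁} {O₂} C along against i ∘ signVec-injective O O₁ O₂ (Cycle.edg C i)

module _ {n m : ℕ} (G : Graph n m) (O : Orientation m) (D : Orientation m → Set)
         (component : IsComponent G D) where
  open Cycle
  open import Data.Rational using (_+_; _≤_)
  import Data.Rational.Properties as ℚ

  private
    x : Orientation m → Vecℚ m
    x = signVec O

    closed : ∀ {O₁ O₂} → D O₁ → CycleReversal G O₁ O₂ → D O₂
    closed = proj₁ (proj₂ component) _ _

    same-indeg : ∀ {O₁ O₂} → D O₁ → D O₂ → ∀ v → indeg G O₁ v ≡ indeg G O₂ v
    same-indeg O₁∈D O₂∈D = indeg-connected G (proj₂ (proj₂ component) _ _ O₁∈D O₂∈D)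

  reversal⇒edge : ∀ {O₁ O₂} → D O₁ → D O₂ → CycleReversal G O₁ O₂ → IsEdgeOf (InHull O D) (x O₁) (x O₂)
  reversal⇒edge {O₁} {O₂} O₁∈D O₂∈D reversal@(C , along , against , outside) =
      (edg C zero , signVec-differ-on-cycle G O {O₁} {O₂} C along against zero)
    , c , dot c (x O₁) , (λ _ → hull-bounded O D {c} bounded)
    , λ y → mk⇔ (uncurry (face⊆segment O D {c} bounded maximisers))
                (segment⊆face O D {c} O₁∈D O₂∈D refl (pairFunctional-symmetric O O₁ O₂))
    where
    c = pairFunctional O O₁ O₂
    bounded : ∀ O′ → D O′ → dot c (x O′) ≤ dot c (x O₁)
    bounded O′ _ = pairFunctional-bound O O₁ O₂ O′
    maximisers : ∀ O′ → D O′ → dot c (x O′) ≡ dot c (x O₁) →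
                 (∀ e → x O′ e ≡ x O₁ e) ⊎ (∀ e → x O′ e ≡ x O₂ e)
    maximisers O′ O′∈D max =
      Sum.map (λ eq e → signVec-cong O O′ O₁ e (eq e)) (λ eq e → signVec-cong O O′ O₂ e (eq e))
        (agree-off-reversed-cycle G {O₁} {O₂} {O′} reversal
          (λ f f∉ → sym (pairFunctional-maximiser O O₁ O₂ {O′} max f (outside f f∉)))
          (same-indeg O₁∈D O′∈D))

  edge⇒agree-off-cycle : ∀ {O₁ O₂} → D O₁ → D O₂ → IsEdgeOf (InHull O D) (x O₁) (x O₂) →
    (C : Cycle G) → Along G O₁ C → Against G O₂ C → ∀ f → ¬ InCycle C f → lookup O₁ f ≡ lookup O₂ f
  edge⇒agree-off-cycle {O₁} {O₂} O₁∈D O₂∈D (_ , c , β , bounded , face) C along against f f∉ =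
    signVec-injective O O₁ O₂ f
      (trans (signVec-cong O O₁ O₃ f (sym (reverseOn-outside G C O₁ f f∉))) (x₃≗x₂ f))
    where
    O₃ O₄ : Orientation m
    O₃ = reverseOn G C O₁
    O₄ = reverseOn G C O₂
    O₃∈D : D O₃
    O₃∈D = closed O₁∈D (reversal-reverseOn G C O₁ along)
    O₄∈D : D O₄
    O₄∈D = closed O₂∈D (CycleReversal-sym G {O₄} {O₂} (reverseOn-reversal G C O₂ against))
    O₃≡O₂-on-C : ∀ i → lookup O₃ (edg C i) ≡ lookup O₂ (edg C i)
    O₃≡O₂-on-C i = trans (reverseOn-against G C O₁ along i) (sym (against i))
    O₄≡O₁-on-C : ∀ i → lookup O₄ (edg C i) ≡ lookup O₁ (edg C i)
    O₄≡O₁-on-C i = trans (reverseOn-along G C O₂ against i) (sym (along i))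

    on-face : ∀ {y} → InSegment (x O₁) (x O₂) y → dot c y ≡ β
    on-face {y} = proj₂ ∘ Equivalence.from (face y)

    x₃+x₄ : ∀ e → x O₃ e + x O₄ e ≡ x O₁ e + x O₂ e
    x₃+x₄ = InCycle-elim G C {P = λ e → x O₃ e + x O₄ e ≡ x O₁ e + x O₂ e}
      (λ i → trans (cong₂ _+_ (signVec-cong O O₃ O₂ (edg C i) (O₃≡O₂-on-C i))
                              (signVec-cong O O₄ O₁ (edg C i) (O₄≡O₁-on-C i)))
                   (ℚ.+-comm (x O₂ (edg C i)) (x O₁ (edg C i))))
      (λ f f∉ → cong₂ _+_ (signVec-cong O O₃ O₁ f (reverseOn-outside G C O₁ f f∉))
                          (signVec-cong O O₄ O₂ f (reverseOn-outside G C O₂ f f∉)))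

    dot₃≡β : dot c (x O₃) ≡ β
    dot₃≡β = +-mono-≤-≡ˡ (bounded _ (vertex∈hull O D O₃∈D)) (bounded _ (vertex∈hull O D O₄∈D)) (begin
      dot c (x O₃) + dot c (x O₄)    ≡⟨ dot-+ c (x O₃) (x O₄) ⟨
      dot c (λ e → x O₃ e + x O₄ e)  ≡⟨ dot-cong c x₃+x₄ ⟩
      dot c (λ e → x O₁ e + x O₂ e)  ≡⟨ dot-+ c (x O₁) (x O₂) ⟩
      dot c (x O₁) + dot c (x O₂)    ≡⟨ cong₂ _+_ (on-face (left∈segment (x O₁) (x O₂)))
                                                  (on-face (right∈segment (x O₁) (x O₂))) ⟩
      β + β                          ∎)
      where open ≡-Reasoning

    x₃≗x₂ : ∀ e → x O₃ e ≡ x O₂ e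
    x₃≗x₂ = segment-meets-right {a = x O₁} {x O₂} {x O₃}
      (Equivalence.to (face (x O₃)) (vertex∈hull O D O₃∈D , dot₃≡β)) {edg C zero}
      (signVec-differ-on-cycle G O {O₁} {O₂} C along against zero)
      (signVec-cong O O₃ O₂ (edg C zero) (O₃≡O₂-on-C zero))

  edge⇒reversal : ∀ {O₁ O₂} → D O₁ → D O₂ → IsEdgeOf (InHull O D) (x O₁) (x O₂) → CycleReversal G O₁ O₂
  edge⇒reversal {O₁} {O₂} O₁∈D O₂∈D edge@((e , x₁≢x₂) , _) =
    reversal (differ-cycle G {O₁} {O₂} (same-indeg O₁∈D O₂∈D) (x₁≢x₂ ∘ signVec-cong O O₁ O₂ e))
    where
    reversal : Σ (Cycle G) (λ C → Along G O₁ C × ∀ i → Differ G O₁ O₂ (edg C i)) → CycleReversal G O₁ O₂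
    reversal (C , along , differ-on-C) =
      C , along , against , edge⇒agree-off-cycle O₁∈D O₂∈D edge C along against
      where
      against : Against G O₂ C
      against i = trans (Bool.¬-not (differ-on-C i ∘ sym)) (cong not (along i))

proposition9p14 : (n m : ℕ) (G : Graph n m) (O : Orientation m)
    (D : Orientation m → Set) → IsComponent G D →
    ∀ O₁ O₂ → D O₁ → D O₂ →
    (CycleReversal G O₁ O₂ ⇔ IsEdgeOf (InHull O D) (signVec O O₁) (signVec O O₂))
proposition9p14 n m G O D component O₁ O₂ O₁∈D O₂∈D =
  mk⇔ (reversal⇒edge G O D component O₁∈D O₂∈D) (edge⇒reversal G O D component O₁∈D O₂∈D)
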